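{- Let $\tau$ be a finite unary vocabulary, $c_\tau := 15|\tau|2^{|\tau|}$, $d$ a positive integer, and $\mathfrak{M}$ a $\tau$-model of size $n$. Then $C_d(\mathfrak{M}) \leq 6d - 3 + c_\tau$.
   Context: A $\tau$-model of size $n$ has domain $\{1,\dots,n\}$ and interprets each unary symbol as a subset. A $\tau$-type is a subset of $\tau$; $|\pi|_{\mathfrak{M}}$ is the number of points lying in exactly the relations named in $\pi$. $\mathfrak{M}\equiv_d\mathfrak{M}'$ (for models of size $n$) iff every type $\pi$ with $|\pi|_{\mathfrak{M}}<d$ has $|\pi|_{\mathfrak{M}}=|\pi|_{\mathfrak{M}'}$. $\mathrm{FO}_d[\tau]$ is first-order logic (negation normal form) restricted to quantifier rank at most $d$. Formula size counts atomic formulas (negated or not), conjunctions, disjunctions and quantifiers, not negations. $C_d(\mathfrak{M})$ is the minimum size of an $\mathrm{FO}_d[\tau]$-sentence true in exactly those $\tau$-models of size $n$ that are $\equiv_d$-equivalent to $\mathfrak{M}$. -}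

module Defs where

open import Data.Nat using (ℕ; zero; suc; _+_; _*_; _^_; _∸_; _<_; _≤_)
open import Data.Fin using (Fin; zero; suc)
open import Data.Fin.Properties using (all?)
open import Data.Bool using (Bool; true; false)
import Data.Bool.Properties as BoolP
open import Data.Product using (Σ; _×_; _,_)
open import Relation.Binary.PropositionalEquality using (_≡_; _≢_)
open import Relation.Nullary.Decidable using (⌊_⌋)
import Data.Nat
import Data.Sum

-- Vocabulary τ with |τ| = k unary relation symbols, named by Fin k.
-- A τ-model of size n: domain Fin n (i.e. {1,…,n}), each symbol a subset.
Model : ℕ → ℕ → Set
Model k n = Fin k → Fin n → Bool

-- A τ-type π ⊆ τ, as its characteristic function.
TauType : ℕ → Set
TauType k = Fin k → Bool

countFin : ∀ {n} → (Fin n → Bool) → ℕ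
countFin {zero}  p = 0
countFin {suc n} p with p zero
... | true  = suc (countFin (λ i → p (suc i)))
... | false = countFin (λ i → p (suc i))

hasType : ∀ {k n} → Model k n → TauType k → Fin n → Bool
hasType M π a = ⌊ all? (λ R → M R a BoolP.≟ π R) ⌋

typeCount : ∀ {k n} → Model k n → TauType k → ℕ
typeCount M π = countFin (hasType M π)

_≡[_]_ : ∀ {k n} → Model k n → ℕ → Model k n → Set
M ≡[ d ] M' = ∀ π → typeCount M π < d → typeCount M π ≡ typeCount M' π

-- First-order formulas in negation normal form over τ (with equality),
-- with m free variables (de Bruijn indices, Fin m).
data Form (k : ℕ) : ℕ → Set where
  rel    : ∀ {m} → Fin k → Fin m → Form k m
  nrel   : ∀ {m} → Fin k → Fin m → Form k m
  eq     : ∀ {m} → Fin m → Fin m → Form k m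
  neq    : ∀ {m} → Fin m → Fin m → Form k m
  _∧ᶠ_   : ∀ {m} → Form k m → Form k m → Form k m
  _∨ᶠ_   : ∀ {m} → Form k m → Form k m → Form k m
  exᶠ    : ∀ {m} → Form k (suc m) → Form k m
  allᶠ   : ∀ {m} → Form k (suc m) → Form k m

Sentence : ℕ → Set
Sentence k = Form k 0

qr : ∀ {k m} → Form k m → ℕ
qr (rel _ _)  = 0
qr (nrel _ _) = 0
qr (eq _ _)   = 0
qr (neq _ _)  = 0
qr (φ ∧ᶠ ψ)   = qr φ Data.Nat.⊔ qr ψ
qr (φ ∨ᶠ ψ)   = qr φ Data.Nat.⊔ qr ψ
qr (exᶠ φ)    = suc (qr φ)
qr (allᶠ φ)   = suc (qr φ)

-- size: atoms (negated or not), connectives and quantifiers; negations free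
size : ∀ {k m} → Form k m → ℕ
size (rel _ _)  = 1
size (nrel _ _) = 1
size (eq _ _)   = 1
size (neq _ _)  = 1
size (φ ∧ᶠ ψ)   = suc (size φ + size ψ)
size (φ ∨ᶠ ψ)   = suc (size φ + size ψ)
size (exᶠ φ)    = suc (size φ)
size (allᶠ φ)   = suc (size φ)

extend : ∀ {n m} → Fin n → (Fin m → Fin n) → Fin (suc m) → Fin n
extend a ρ zero    = a
extend a ρ (suc i) = ρ i

Sat : ∀ {k n m} → Model k n → Form k m → (Fin m → Fin n) → Set
Sat M (rel R x)  ρ = M R (ρ x) ≡ true
Sat M (nrel R x) ρ = M R (ρ x) ≡ false
Sat M (eq x y)   ρ = ρ x ≡ ρ y
Sat M (neq x y)  ρ = ρ x ≢ ρ y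
Sat M (φ ∧ᶠ ψ)   ρ = Sat M φ ρ × Sat M ψ ρ
Sat M (φ ∨ᶠ ψ)   ρ = Data.Sum._⊎_ (Sat M φ ρ) (Sat M ψ ρ)
Sat M (exᶠ φ)    ρ = Σ _ λ a → Sat M φ (extend a ρ)
Sat M (allᶠ φ)   ρ = ∀ a → Sat M φ (extend a ρ)

_⊨_ : ∀ {k n} → Model k n → Sentence k → Set
M ⊨ φ = Sat M φ (λ ())

cτ : ℕ → ℕ
cτ k = 15 * k * 2 ^ k

module Submission where

-- Let t(a) be the number of elements of M of the same type as a. Then M ≡_d M' iff every type
-- realized between 1 and d − 1 times in M is realized in M', and every element a of M' with
-- t(a) < d has exactly t(a) elements of its type in M'. The sentence states the first part with one
-- ∃x θ_π(x) per such type, and the second with ∀x (t(x) ≥ d ∨ "x has at most and at least t(x)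
-- elements of its type"). With d = ℓ + 2, "at most" is ∃y₁…y_ℓ ∀y (y ≁ x ∨ y is among the first t(x)
-- of x, y₁, …, y_ℓ) and "at least" is ∀y₁…y_ℓ ∃y (y ∼ x ∧ y is not among the first t(x) − 1 of
-- y₁, …, y_ℓ). Since t(x) is not fixed, "among the first t(x)" is the chain
-- t(x) ≠ 0 ∧ (y = x ∨ (t(x) ≠ 1 ∧ (y = y₁ ∨ …))), where t(x) ≠ j is the conjunction of ¬θ_π(x) over the
-- types π realized exactly j times in M. Each type enters only one guard of a chain, so the guards
-- cost O(|τ| 2^|τ|) altogether, while each variable yᵢ costs a quantifier, an (in)equality and a
-- connective in each half; this gives 6d − 3 + c_τ.

open import Defs
open import Data.Bool using (Bool; true; false; not; _∨_; if_then_else_)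
import Data.Bool.Properties as Bool
open import Data.Empty using (⊥)
open import Data.Fin using (Fin; zero; suc)
import Data.Fin as Fin
open import Data.Fin.Properties using (any?; all?; ¬∀⟶∃¬) renaming (_≟_ to _≟ᶠ_)
open import Data.List using (List; []; _∷_; length; map; _++_; take; replicate; filter; filterᵇ)
open import Data.List.Properties
  using ( ++-identityʳ; ++-assoc; map-++; map-∘; length-++; length-map; length-replicate; length-take; take-[]
        ; length-filter; filter-notAll)
open import Data.List.Membership.Propositional using (_∈_; _∉_)
open import Data.List.Membership.Propositional.Properties using (∈-map⁺; ∈-++⁺ˡ; ∈-++⁺ʳ; ∈-filter⁺)
import Data.List.Membership.DecPropositional as DecMembership
open import Data.List.Relation.Unary.Any using (here; there)
import Data.List.Relation.Unary.Any as Any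
open import Data.Nat using (ℕ; zero; suc; pred; _+_; _*_; _∸_; _^_; _≤_; _<_; z≤n; s≤s; _≤?_; _≟_)
open import Data.Nat.Properties
open import Data.Nat.Tactic.RingSolver using (solve-∀)
open import Data.Product using (Σ; ∃; ∃-syntax; _×_; _,_; proj₂; uncurry)
open import Data.Product.Function.NonDependent.Propositional using (_×-⇔_)
open import Data.Sum using (_⊎_; inj₁; inj₂; map₁)
open import Data.Sum.Function.Propositional using (_⊎-⇔_)
open import Data.Vec.Functional using (tail) renaming (_∷_ to _∷ᵛ_)
open import Function using (_∘_)
open import Function.Bundles using (_⇔_; mk⇔; module Equivalence)
import Function.Properties.Equivalence as ⇔
open import Relation.Binary.PropositionalEquality
open import Relation.Nullary using (Dec; yes; no; ¬_; ¬?; contradiction)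
open import Relation.Nullary.Decidable using (isYes; T?; _×-dec_; decidable-stable)
open import Relation.Unary using (Decidable)

open Equivalence using (to; from)

variable
  k m n r T : ℕ
  A : Set

isYes≡true⇔ : ∀ {P : Set} (P? : Dec P) → isYes P? ≡ true ⇔ P
isYes≡true⇔ (yes p) = mk⇔ (λ _ → p) (λ _ → refl)
isYes≡true⇔ (no ¬p) = mk⇔ (λ ()) (λ p → contradiction p ¬p)

∀-⇔ : {P Q : A → Set} → (∀ x → P x ⇔ Q x) → (∀ x → P x) ⇔ (∀ x → Q x)
∀-⇔ P⇔Q = mk⇔ (λ p x → to (P⇔Q x) (p x)) (λ q x → from (P⇔Q x) (q x))

∃-⇔ : {P Q : A → Set} → (∀ x → P x ⇔ Q x) → (∃ P) ⇔ (∃ Q)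
∃-⇔ P⇔Q = mk⇔ (λ (x , p) → x , to (P⇔Q x) p) (λ (x , q) → x , from (P⇔Q x) q)

agree⇔≡ : {b c : Bool} → ((b ≡ true × c ≡ true) ⊎ (b ≡ false × c ≡ false)) ⇔ b ≡ c
agree⇔≡ {true}  {true}  = mk⇔ (λ _ → refl) (λ _ → inj₁ (refl , refl))
agree⇔≡ {true}  {false} = mk⇔ (λ { (inj₁ (_ , ())) ; (inj₂ (() , _)) }) (λ ())
agree⇔≡ {false} {true}  = mk⇔ (λ { (inj₁ (() , _)) ; (inj₂ (_ , ())) }) (λ ())
agree⇔≡ {false} {false} = mk⇔ (λ _ → refl) (λ _ → inj₂ (refl , refl))

disagree⇔≡not : {b c : Bool} → ((b ≡ true × c ≡ false) ⊎ (b ≡ false × c ≡ true)) ⇔ b ≡ not c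
disagree⇔≡not {true}  {true}  = mk⇔ (λ { (inj₁ (_ , ())) ; (inj₂ (() , _)) }) (λ ())
disagree⇔≡not {true}  {false} = mk⇔ (λ _ → refl) (λ _ → inj₁ (refl , refl))
disagree⇔≡not {false} {true}  = mk⇔ (λ _ → refl) (λ _ → inj₂ (refl , refl))
disagree⇔≡not {false} {false} = mk⇔ (λ { (inj₁ (() , _)) ; (inj₂ (_ , ())) }) (λ ())

∃≡not⇔¬≗ : {f g : Fin k → Bool} → (∃[ R ] f R ≡ not (g R)) ⇔ (¬ f ≗ g)
∃≡not⇔¬≗ {k} {f} {g} = mk⇔ (λ (R , fR≡¬gR) f≗g → Bool.not-¬ (f≗g R) fR≡¬gR)
  λ f≉g → let R , fR≢gR = ¬∀⟶∃¬ k _ (λ R → f R Bool.≟ g R) f≉g in R , Bool.¬-not fR≢gR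

Covers : List A → (A → Bool) → Set
Covers L q = ∀ b → q b ≡ true → b ∈ L

∈-take-++ : ∀ {b : A} xs ys → b ∈ xs → length xs ≤ T → b ∈ take T (xs ++ ys)
∈-take-++ {T = suc T} (x ∷ xs) ys (here b≡x) _ = here b≡x
∈-take-++ {T = suc T} (x ∷ xs) ys (there b∈xs) (s≤s |xs|≤T) = there (∈-take-++ xs ys b∈xs |xs|≤T)

length-take≤ : ∀ (xs : List A) → length (take T xs) ≤ T
length-take≤ {T = T} xs = ≤-trans (≤-reflexive (length-take T xs)) (m⊓n≤m T (length xs))

-- Counting in Fin n

countFin-cong : {p q : Fin n → Bool} → p ≗ q → countFin p ≡ countFin q
countFin-cong {zero} p≗q = refl
countFin-cong {suc n} {p} {q} p≗q with p zero | q zero | p≗q zero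
... | true  | .true  | refl = cong suc (countFin-cong (p≗q ∘ suc))
... | false | .false | refl = countFin-cong (p≗q ∘ suc)

∃⇒0<countFin : (p : Fin n → Bool) {a : Fin n} → p a ≡ true → 0 < countFin p
∃⇒0<countFin {suc n} p {a} pa with p zero in p0
... | true = s≤s z≤n
∃⇒0<countFin {suc n} p {zero}  pa | false = contradiction (trans (sym p0) pa) λ ()
∃⇒0<countFin {suc n} p {suc a} pa | false = ∃⇒0<countFin (p ∘ suc) pa

0<countFin⇒∃ : (p : Fin n → Bool) → 0 < countFin p → ∃[ a ] p a ≡ true
0<countFin⇒∃ {suc n} p pos with p zero in p0
... | true  = zero , p0
... | false = let a , pa = 0<countFin⇒∃ (p ∘ suc) pos in suc a , pa

enumerate : (Fin n → Bool) → List (Fin n)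
enumerate {zero}  p = []
enumerate {suc n} p with p zero
... | true  = zero ∷ map suc (enumerate (p ∘ suc))
... | false = map suc (enumerate (p ∘ suc))

length-enumerate : (p : Fin n → Bool) → length (enumerate p) ≡ countFin p
length-enumerate {zero}  p = refl
length-enumerate {suc n} p with p zero
... | true  = cong suc (trans (length-map suc (enumerate (p ∘ suc))) (length-enumerate (p ∘ suc)))
... | false = trans (length-map suc (enumerate (p ∘ suc))) (length-enumerate (p ∘ suc))

enumerate-covers : (p : Fin n → Bool) → Covers (enumerate p) p
enumerate-covers {suc n} p b pb with p zero in p0
enumerate-covers {suc n} p zero    pb | true  = here refl
enumerate-covers {suc n} p (suc b) pb | true  = there (∈-map⁺ suc (enumerate-covers (p ∘ suc) b pb))
enumerate-covers {suc n} p zero    pb | false = contradiction (trans (sym p0) pb) λ ()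
enumerate-covers {suc n} p (suc b) pb | false = ∈-map⁺ suc (enumerate-covers (p ∘ suc) b pb)

predecessors : List (Fin (suc n)) → List (Fin n)
predecessors []          = []
predecessors (zero  ∷ L) = predecessors L
predecessors (suc i ∷ L) = i ∷ predecessors L

length-predecessors : (L : List (Fin (suc n))) → length (predecessors L) ≤ length L
length-predecessors []          = z≤n
length-predecessors (zero  ∷ L) = m≤n⇒m≤1+n (length-predecessors L)
length-predecessors (suc i ∷ L) = s≤s (length-predecessors L)

length-predecessors-< : (L : List (Fin (suc n))) → zero ∈ L → length (predecessors L) < length L
length-predecessors-< (zero  ∷ L) _            = s≤s (length-predecessors L)
length-predecessors-< (suc i ∷ L) (there 0∈L) = s≤s (length-predecessors-< L 0∈L)

∈-predecessors : {i : Fin n} (L : List (Fin (suc n))) → suc i ∈ L → i ∈ predecessors L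
∈-predecessors (zero  ∷ L) (there i∈L) = ∈-predecessors L i∈L
∈-predecessors (suc j ∷ L) (here refl) = here refl
∈-predecessors (suc j ∷ L) (there i∈L) = there (∈-predecessors L i∈L)

covers-predecessors : (p : Fin (suc n) → Bool) (L : List (Fin (suc n))) → Covers L p → Covers (predecessors L) (p ∘ suc)
covers-predecessors p L cov b pb = ∈-predecessors L (cov (suc b) pb)

countFin≤length : (p : Fin n → Bool) (L : List (Fin n)) → Covers L p → countFin p ≤ length L
countFin≤length {zero}  p L cov = z≤n
countFin≤length {suc n} p L cov with p zero in p0
... | true  = ≤-trans (s≤s (countFin≤length (p ∘ suc) (predecessors L) (covers-predecessors p L cov)))
                      (length-predecessors-< L (cov zero p0))
... | false = ≤-trans (countFin≤length (p ∘ suc) (predecessors L) (covers-predecessors p L cov))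
                      (length-predecessors L)

_∈?_ : (b : Fin n) (L : List (Fin n)) → Dec (b ∈ L)
b ∈? L = DecMembership._∈?_ _≟ᶠ_ b L

uncovered : (p : Fin n → Bool) (L : List (Fin n)) → length L < countFin p → ∃[ b ] p b ≡ true × b ∉ L
uncovered p L |L|<count with any? (λ b → (p b Bool.≟ true) ×-dec ¬? (b ∈? L))
... | yes found = found
... | no  none  = contradiction (countFin≤length p L covered) (<⇒≱ |L|<count)
  where
  covered : Covers L p
  covered b pb = decidable-stable (b ∈? L) λ b∉L → none (b , pb , b∉L)

coveringList : (q : Fin n → Bool) {a : Fin n} → q a ≡ true → countFin q ≤ T → T ≤ suc r →
               ∃[ as ] length as ≡ r × Covers (take T (a ∷ as)) q
coveringList {T = zero} q qa count≤0 _ = contradiction count≤0 (<⇒≱ (∃⇒0<countFin q qa))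
coveringList {T = suc s} {r = r} q {a} qa count≤ 1+s≤1+r =
  others ++ replicate (r ∸ length others) a , length-as , covers
  where
  others : List (Fin _)
  others = filter (λ b → ¬? (b ≟ᶠ a)) (enumerate q)
  others≤s : length others ≤ s
  others≤s = ≤-pred (≤-trans
    (filter-notAll _ (enumerate q) (Any.map (λ a≡b b≢a → b≢a (sym a≡b)) (enumerate-covers q a qa)))
    (≤-trans (≤-reflexive (length-enumerate q)) count≤))
  length-as : length (others ++ replicate (r ∸ length others) a) ≡ r
  length-as = trans (length-++ others) (trans (cong (length others +_) (length-replicate (r ∸ length others)))
                (m+[n∸m]≡n (≤-trans others≤s (≤-pred 1+s≤1+r))))
  covers : Covers (a ∷ take s (others ++ replicate (r ∸ length others) a)) q
  covers b qb with b ≟ᶠ a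
  ... | yes b≡a = here b≡a
  ... | no  b≢a = there (∈-take-++ others _ (∈-filter⁺ (λ b → ¬? (b ≟ᶠ a)) (enumerate-covers q b qb) b≢a) others≤s)

countFin≤⇔covered : (q : Fin n → Bool) {a : Fin n} → q a ≡ true → T ≤ suc r →
                    countFin q ≤ T ⇔ (∃[ as ] length as ≡ r × Covers (take T (a ∷ as)) q)
countFin≤⇔covered q qa T≤1+r = mk⇔ (λ count≤T → coveringList q qa count≤T T≤1+r)
  λ (as , _ , covers) → ≤-trans (countFin≤length q _ covers) (length-take≤ (_ ∷ as))

≤countFin⇔uncovered : (q : Fin n → Bool) {a : Fin n} → q a ≡ true → T ≤ r →
                      suc T ≤ countFin q ⇔ (∀ as → length as ≡ r → ∃[ b ] q b ≡ true × b ∉ take T as)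
≤countFin⇔uncovered {T = T} {r} q {a} qa T≤r = mk⇔
  (λ 1+T≤count as _ → uncovered q (take T as) (≤-trans (s≤s (length-take≤ as)) 1+T≤count))
  λ escapes → decidable-stable (suc T ≤? countFin q) λ 1+T≰count → refuted r T≤r escapes (≤-pred (≰⇒> 1+T≰count))
  where
  refuted : ∀ r → T ≤ r → (∀ as → length as ≡ r → ∃[ b ] q b ≡ true × b ∉ take T as) → countFin q ≤ T → ⊥
  refuted zero    T≤0   _       count≤T = contradiction (≤-trans count≤T T≤0) (<⇒≱ (∃⇒0<countFin q qa))
  refuted (suc r) T≤1+r escapes count≤T with coveringList q qa count≤T T≤1+r
  ... | as , |as|≡r , covers with escapes (a ∷ as) (cong suc |as|≡r)
  ...   | b , qb , b∉ = b∉ (covers b qb)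

-- Types

typeOf : Model k n → Fin n → TauType k
typeOf M a R = M R a

typeClass : Model k n → Fin n → Fin n → Bool
typeClass M a = hasType M (typeOf M a)

hasType≡true⇔ : (M : Model k n) (π : TauType k) (a : Fin n) → hasType M π a ≡ true ⇔ typeOf M a ≗ π
hasType≡true⇔ M π a = isYes≡true⇔ (all? λ R → M R a Bool.≟ π R)

typeCount-cong : (M : Model k n) {π π₁ : TauType k} → π ≗ π₁ → typeCount M π ≡ typeCount M π₁
typeCount-cong M {π} {π₁} π≗π₁ = countFin-cong λ a → Bool.⇔→≡
  (⇔.trans (hasType≡true⇔ M π a) (⇔.trans ≗π⇔≗π₁ (⇔.sym (hasType≡true⇔ M π₁ a))))
  where
  ≗π⇔≗π₁ : ∀ {τ : TauType _} → τ ≗ π ⇔ τ ≗ π₁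
  ≗π⇔≗π₁ = mk⇔ (λ τ≗π R → trans (τ≗π R) (π≗π₁ R))
               (λ τ≗π₁ R → trans (τ≗π₁ R) (sym (π≗π₁ R)))

allTypes : (k : ℕ) → List (TauType k)
allTypes zero    = (λ ()) ∷ []
allTypes (suc k) = map (true ∷ᵛ_) (allTypes k) ++ map (false ∷ᵛ_) (allTypes k)

length-allTypes : (k : ℕ) → length (allTypes k) ≡ 2 ^ k
length-allTypes zero    = refl
length-allTypes (suc k) = begin
  length (map (true ∷ᵛ_) (allTypes k) ++ map (false ∷ᵛ_) (allTypes k))
    ≡⟨ length-++ (map (true ∷ᵛ_) (allTypes k)) ⟩
  length (map (true ∷ᵛ_) (allTypes k)) + length (map (false ∷ᵛ_) (allTypes k))
    ≡⟨ cong₂ _+_ (length-map (true ∷ᵛ_) (allTypes k)) (length-map (false ∷ᵛ_) (allTypes k)) ⟩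
  length (allTypes k) + length (allTypes k)
    ≡⟨ cong (λ x → x + x) (length-allTypes k) ⟩
  2 ^ k + 2 ^ k
    ≡⟨ cong (2 ^ k +_) (sym (+-identityʳ (2 ^ k))) ⟩
  2 ^ suc k ∎
  where open ≡-Reasoning

allTypes-complete : (π : TauType k) → ∃[ π₁ ] π₁ ∈ allTypes k × π₁ ≗ π
allTypes-complete {zero}  π = (λ ()) , here refl , λ ()
allTypes-complete {suc k} π with allTypes-complete (tail π) | π zero in π₀
... | τ , τ∈ , τ≗ | true  =
  true ∷ᵛ τ , ∈-++⁺ˡ (∈-map⁺ (true ∷ᵛ_) τ∈) , λ { zero → sym π₀ ; (suc R) → τ≗ R }
... | τ , τ∈ , τ≗ | false =
  false ∷ᵛ τ , ∈-++⁺ʳ _ (∈-map⁺ (false ∷ᵛ_) τ∈) , λ { zero → sym π₀ ; (suc R) → τ≗ R }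

≡[1+ℓ]⇔ : (M M' : Model k n) (ℓ : ℕ) → M ≡[ suc ℓ ] M' ⇔
          ((∀ π → 1 ≤ typeCount M π → typeCount M π ≤ ℓ → ∃[ a ] typeOf M' a ≗ π) ×
           (∀ a → typeCount M (typeOf M' a) ≤ ℓ → typeCount M' (typeOf M' a) ≡ typeCount M (typeOf M' a)))
≡[1+ℓ]⇔ M M' ℓ = mk⇔ (λ M≡M' → realized M≡M' , exact M≡M') (uncurry equivalent)
  where
  Realized Exact : Set
  Realized = ∀ π → 1 ≤ typeCount M π → typeCount M π ≤ ℓ → ∃[ a ] typeOf M' a ≗ π
  Exact    = ∀ a → typeCount M (typeOf M' a) ≤ ℓ → typeCount M' (typeOf M' a) ≡ typeCount M (typeOf M' a)
  exact : M ≡[ suc ℓ ] M' → Exact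
  exact M≡M' a t≤ℓ = sym (M≡M' (typeOf M' a) (s≤s t≤ℓ))
  realized : M ≡[ suc ℓ ] M' → Realized
  realized M≡M' π 1≤c c≤ℓ = let a , πa = 0<countFin⇒∃ (hasType M' π) (subst (1 ≤_) (M≡M' π (s≤s c≤ℓ)) 1≤c)
                            in a , to (hasType≡true⇔ M' π a) πa
  equivalent : Realized → Exact → M ≡[ suc ℓ ] M'
  equivalent realizes isExact π c<1+ℓ with 1 ≤? typeCount M' π
  ... | yes 1≤c' = let a , πa = 0<countFin⇒∃ (hasType M' π) 1≤c'
                       a≗π = to (hasType≡true⇔ M' π a) πa
                       c≡t = typeCount-cong M (sym ∘ a≗π)
                   in trans c≡t (trans (sym (isExact a (subst (_≤ ℓ) c≡t (≤-pred c<1+ℓ)))) (typeCount-cong M' a≗π))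
  ... | no  1≰c' with 1 ≤? typeCount M π
  ...   | no  1≰c = trans (n<1⇒n≡0 (≰⇒> 1≰c)) (sym (n<1⇒n≡0 (≰⇒> 1≰c')))
  ...   | yes 1≤c = let a , a≗π = realizes π 1≤c (≤-pred c<1+ℓ)
                    in contradiction (∃⇒0<countFin (hasType M' π) (from (hasType≡true⇔ M' π a) a≗π)) 1≰c'

emptyVocabulary-≡ : (M M' : Model 0 n) (d : ℕ) → M ≡[ d ] M'
emptyVocabulary-≡ M M' d π _ =
  countFin-cong λ a → trans (from (hasType≡true⇔ M π a) λ ()) (sym (from (hasType≡true⇔ M' π a) λ ()))

countWhere : (A → Bool) → List A → ℕ
countWhere f xs = length (filterᵇ f xs)

countWhere≤length : (f : A → Bool) (xs : List A) → countWhere f xs ≤ length xs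
countWhere≤length f = length-filter (T? ∘ f)

countWhere-false : (xs : List A) → countWhere (λ _ → false) xs ≡ 0
countWhere-false []       = refl
countWhere-false (x ∷ xs) = countWhere-false xs

countWhere-∨ : (f g : A → Bool) → (∀ x → f x ≡ true → g x ≡ false) → (xs : List A) →
               countWhere (λ x → f x ∨ g x) xs ≡ countWhere f xs + countWhere g xs
countWhere-∨ f g disjoint [] = refl
countWhere-∨ f g disjoint (x ∷ xs) with f x in fx | g x in gx
... | true  | true  = contradiction (trans (sym gx) (disjoint x fx)) λ ()
... | true  | false = cong suc (countWhere-∨ f g disjoint xs)
... | false | true  = trans (cong suc (countWhere-∨ f g disjoint xs)) (sym (+-suc _ _))
... | false | false = countWhere-∨ f g disjoint xs

-- Formulas

⋀ : (j : ℕ) → (Fin (suc j) → Form k m) → Form k m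
⋀ zero    φ = φ zero
⋀ (suc j) φ = φ zero ∧ᶠ ⋀ j (φ ∘ suc)

⋁ : (j : ℕ) → (Fin (suc j) → Form k m) → Form k m
⋁ zero    φ = φ zero
⋁ (suc j) φ = φ zero ∨ᶠ ⋁ j (φ ∘ suc)

module _ (M : Model k n) where

  Sat-⋀ : (j : ℕ) (φ : Fin (suc j) → Form k m) (σ : Fin m → Fin n) →
          Sat M (⋀ j φ) σ ⇔ (∀ i → Sat M (φ i) σ)
  Sat-⋀ zero    φ σ = mk⇔ (λ { s zero → s }) (λ s → s zero)
  Sat-⋀ (suc j) φ σ = mk⇔
    (λ { (s , _) zero → s ; (_ , ss) (suc i) → to (Sat-⋀ j (φ ∘ suc) σ) ss i })
    (λ s → s zero , from (Sat-⋀ j (φ ∘ suc) σ) (s ∘ suc))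

  Sat-⋁ : (j : ℕ) (φ : Fin (suc j) → Form k m) (σ : Fin m → Fin n) →
          Sat M (⋁ j φ) σ ⇔ (∃[ i ] Sat M (φ i) σ)
  Sat-⋁ zero    φ σ = mk⇔ (zero ,_) (λ { (zero , s) → s })
  Sat-⋁ (suc j) φ σ = mk⇔
    (λ { (inj₁ s) → zero , s ; (inj₂ ss) → let i , s = to (Sat-⋁ j (φ ∘ suc) σ) ss in suc i , s })
    (λ { (zero , s) → inj₁ s ; (suc i , s) → inj₂ (from (Sat-⋁ j (φ ∘ suc) σ) (i , s)) })

size-⋀ : (j : ℕ) (φ : Fin (suc j) → Form k m) {s : ℕ} → (∀ i → size (φ i) ≡ s) → size (⋀ j φ) ≡ s + j * suc s
size-⋀ zero    φ {s} sφ = trans (sφ zero) (sym (+-identityʳ s))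
size-⋀ (suc j) φ {s} sφ = trans (cong₂ (λ a b → suc (a + b)) (sφ zero) (size-⋀ j (φ ∘ suc) (sφ ∘ suc))) (sym (+-suc s _))

size-⋁ : (j : ℕ) (φ : Fin (suc j) → Form k m) {s : ℕ} → (∀ i → size (φ i) ≡ s) → size (⋁ j φ) ≡ s + j * suc s
size-⋁ zero    φ {s} sφ = trans (sφ zero) (sym (+-identityʳ s))
size-⋁ (suc j) φ {s} sφ = trans (cong₂ (λ a b → suc (a + b)) (sφ zero) (size-⋁ j (φ ∘ suc) (sφ ∘ suc))) (sym (+-suc s _))

qr-⋀ : (j : ℕ) (φ : Fin (suc j) → Form k m) {b : ℕ} → (∀ i → qr (φ i) ≤ b) → qr (⋀ j φ) ≤ b
qr-⋀ zero    φ qφ = qφ zero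
qr-⋀ (suc j) φ qφ = ⊔-lub (qφ zero) (qr-⋀ j (φ ∘ suc) (qφ ∘ suc))

qr-⋁ : (j : ℕ) (φ : Fin (suc j) → Form k m) {b : ℕ} → (∀ i → qr (φ i) ≤ b) → qr (⋁ j φ) ≤ b
qr-⋁ zero    φ qφ = qφ zero
qr-⋁ (suc j) φ qφ = ⊔-lub (qφ zero) (qr-⋁ j (φ ∘ suc) (qφ ∘ suc))

lit : Bool → Fin k → Fin m → Form k m
lit true  R x = rel R x
lit false R x = nrel R x

isType : TauType (suc k) → Fin m → Form (suc k) m
isType {k} π x = ⋀ k λ R → lit (π R) R x

notType : TauType (suc k) → Fin m → Form (suc k) m
notType {k} π x = ⋁ k λ R → lit (not (π R)) R x

sameType : Fin m → Fin m → Form (suc k) m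
sameType {k = k} x y = ⋀ k λ R → (rel R x ∧ᶠ rel R y) ∨ᶠ (nrel R x ∧ᶠ nrel R y)

diffType : Fin m → Fin m → Form (suc k) m
diffType {k = k} x y = ⋁ k λ R → (rel R x ∧ᶠ nrel R y) ∨ᶠ (nrel R x ∧ᶠ rel R y)

module _ (M : Model k n) {σ : Fin m → Fin n} where

  Sat-lit : (b : Bool) (R : Fin k) (x : Fin m) → Sat M (lit b R x) σ ⇔ M R (σ x) ≡ b
  Sat-lit true  R x = ⇔.refl
  Sat-lit false R x = ⇔.refl

module _ {k : ℕ} (M : Model (suc k) n) {σ : Fin m → Fin n} where

  Sat-isType : (π : TauType (suc k)) (x : Fin m) → Sat M (isType π x) σ ⇔ typeOf M (σ x) ≗ π
  Sat-isType π x = ⇔.trans (Sat-⋀ M k _ σ) (∀-⇔ λ R → Sat-lit M (π R) R x)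

  Sat-notType : (π : TauType (suc k)) (x : Fin m) → Sat M (notType π x) σ ⇔ (¬ typeOf M (σ x) ≗ π)
  Sat-notType π x = ⇔.trans (Sat-⋁ M k _ σ) (⇔.trans (∃-⇔ λ R → Sat-lit M (not (π R)) R x) ∃≡not⇔¬≗)

  Sat-sameType : (x y : Fin m) → Sat M (sameType x y) σ ⇔ typeOf M (σ x) ≗ typeOf M (σ y)
  Sat-sameType x y = ⇔.trans (Sat-⋀ M k _ σ) (∀-⇔ λ R → agree⇔≡)

  Sat-diffType : (x y : Fin m) → Sat M (diffType x y) σ ⇔ (¬ typeOf M (σ x) ≗ typeOf M (σ y))
  Sat-diffType x y = ⇔.trans (Sat-⋁ M k _ σ) (⇔.trans (∃-⇔ λ R → disagree⇔≡not) ∃≡not⇔¬≗)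

size-lit : (b : Bool) (R : Fin k) (x : Fin m) → size (lit b R x) ≡ 1
size-lit true  R x = refl
size-lit false R x = refl

size-isType : (π : TauType (suc k)) (x : Fin m) → size (isType π x) ≡ 1 + k * 2
size-isType {k} π x = size-⋀ k _ λ R → size-lit (π R) R x

size-notType : (π : TauType (suc k)) (x : Fin m) → size (notType π x) ≡ 1 + k * 2
size-notType {k} π x = size-⋁ k _ λ R → size-lit (not (π R)) R x

size-sameType : (x y : Fin m) → size (sameType {k = k} x y) ≡ 7 + k * 8
size-sameType {k = k} x y = size-⋀ k _ λ R → refl

size-diffType : (x y : Fin m) → size (diffType {k = k} x y) ≡ 7 + k * 8
size-diffType {k = k} x y = size-⋁ k _ λ R → refl

qr-lit : (b : Bool) (R : Fin k) (x : Fin m) → qr (lit b R x) ≤ 0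
qr-lit true  R x = z≤n
qr-lit false R x = z≤n

qr-isType : (π : TauType (suc k)) (x : Fin m) → qr (isType π x) ≤ 0
qr-isType {k} π x = qr-⋀ k _ λ R → qr-lit (π R) R x

qr-notType : (π : TauType (suc k)) (x : Fin m) → qr (notType π x) ≤ 0
qr-notType {k} π x = qr-⋁ k _ λ R → qr-lit (not (π R)) R x

qr-sameType : (x y : Fin m) → qr (sameType {k = k} x y) ≤ 0
qr-sameType {k = k} x y = qr-⋀ k _ λ R → z≤n

qr-diffType : (x y : Fin m) → qr (diffType {k = k} x y) ≤ 0
qr-diffType {k = k} x y = qr-⋁ k _ λ R → z≤n

conjWhere : List A → (A → Bool) → (A → Form k m) → Form k m → Form k m
conjWhere []       f φ ψ = ψ
conjWhere (x ∷ xs) f φ ψ = if f x then φ x ∧ᶠ conjWhere xs f φ ψ else conjWhere xs f φ ψ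

disjWhere : List A → (A → Bool) → (A → Form k m) → Form k m → Form k m
disjWhere []       f φ ψ = ψ
disjWhere (x ∷ xs) f φ ψ = if f x then φ x ∨ᶠ disjWhere xs f φ ψ else disjWhere xs f φ ψ

module _ (M : Model k n) {σ : Fin m → Fin n} where

  Sat-conjWhere : (xs : List A) (f : A → Bool) (φ : A → Form k m) (ψ : Form k m) →
                  Sat M (conjWhere xs f φ ψ) σ ⇔ ((∀ x → x ∈ xs → f x ≡ true → Sat M (φ x) σ) × Sat M ψ σ)
  Sat-conjWhere []       f φ ψ = mk⇔ (λ s → (λ _ ()) , s) proj₂
  Sat-conjWhere (x ∷ xs) f φ ψ with f x in fx
  ... | true  = mk⇔
    (λ (φx , rest) → let each , ψs = to (Sat-conjWhere xs f φ ψ) rest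
                     in (λ { _ (here refl) _ → φx ; y (there y∈) fy → each y y∈ fy }) , ψs)
    (λ (each , ψs) → each x (here refl) fx , from (Sat-conjWhere xs f φ ψ) ((λ y → each y ∘ there) , ψs))
  ... | false = mk⇔
    (λ rest → let each , ψs = to (Sat-conjWhere xs f φ ψ) rest
              in (λ { _ (here refl) fy → contradiction (trans (sym fx) fy) λ () ; y (there y∈) fy → each y y∈ fy }) , ψs)
    (λ (each , ψs) → from (Sat-conjWhere xs f φ ψ) ((λ y → each y ∘ there) , ψs))

  Sat-disjWhere : (xs : List A) (f : A → Bool) (φ : A → Form k m) (ψ : Form k m) →
                  Sat M (disjWhere xs f φ ψ) σ ⇔ ((∃[ x ] x ∈ xs × f x ≡ true × Sat M (φ x) σ) ⊎ Sat M ψ σ)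
  Sat-disjWhere []       f φ ψ = mk⇔ inj₂ λ { (inj₁ (_ , () , _)) ; (inj₂ s) → s }
  Sat-disjWhere (x ∷ xs) f φ ψ with f x in fx
  ... | true  = mk⇔
    (λ { (inj₁ φx) → inj₁ (x , here refl , fx , φx)
       ; (inj₂ rest) → map₁ (λ (y , y∈ , fy , φy) → y , there y∈ , fy , φy) (to (Sat-disjWhere xs f φ ψ) rest) })
    (λ { (inj₁ (_ , here refl , _ , φx)) → inj₁ φx
       ; (inj₁ (y , there y∈ , fy , φy)) → inj₂ (from (Sat-disjWhere xs f φ ψ) (inj₁ (y , y∈ , fy , φy)))
       ; (inj₂ ψs) → inj₂ (from (Sat-disjWhere xs f φ ψ) (inj₂ ψs)) })
  ... | false = mk⇔
    (λ rest → map₁ (λ (y , y∈ , fy , φy) → y , there y∈ , fy , φy) (to (Sat-disjWhere xs f φ ψ) rest))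
    (λ { (inj₁ (_ , here refl , fy , _)) → contradiction (trans (sym fx) fy) λ ()
       ; (inj₁ (y , there y∈ , fy , φy)) → from (Sat-disjWhere xs f φ ψ) (inj₁ (y , y∈ , fy , φy))
       ; (inj₂ ψs) → from (Sat-disjWhere xs f φ ψ) (inj₂ ψs) })


size-conjWhere : (xs : List A) (f : A → Bool) (φ : A → Form k m) (ψ : Form k m) {s : ℕ} → (∀ x → size (φ x) ≡ s) →
                 size (conjWhere xs f φ ψ) ≡ countWhere f xs * suc s + size ψ
size-conjWhere []       f φ ψ sφ = refl
size-conjWhere (x ∷ xs) f φ ψ {s} sφ with f x
... | true  = trans (cong₂ (λ a b → suc (a + b)) (sφ x) (size-conjWhere xs f φ ψ sφ)) (cong suc (sym (+-assoc s _ _)))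
... | false = size-conjWhere xs f φ ψ sφ

size-disjWhere : (xs : List A) (f : A → Bool) (φ : A → Form k m) (ψ : Form k m) {s : ℕ} → (∀ x → size (φ x) ≡ s) →
                 size (disjWhere xs f φ ψ) ≡ countWhere f xs * suc s + size ψ
size-disjWhere []       f φ ψ sφ = refl
size-disjWhere (x ∷ xs) f φ ψ {s} sφ with f x
... | true  = trans (cong₂ (λ a b → suc (a + b)) (sφ x) (size-disjWhere xs f φ ψ sφ)) (cong suc (sym (+-assoc s _ _)))
... | false = size-disjWhere xs f φ ψ sφ

qr-conjWhere : (xs : List A) (f : A → Bool) (φ : A → Form k m) (ψ : Form k m) {b : ℕ} →
               (∀ x → qr (φ x) ≤ b) → qr ψ ≤ b → qr (conjWhere xs f φ ψ) ≤ b
qr-conjWhere []       f φ ψ qφ qψ = qψ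
qr-conjWhere (x ∷ xs) f φ ψ qφ qψ with f x
... | true  = ⊔-lub (qφ x) (qr-conjWhere xs f φ ψ qφ qψ)
... | false = qr-conjWhere xs f φ ψ qφ qψ

qr-disjWhere : (xs : List A) (f : A → Bool) (φ : A → Form k m) (ψ : Form k m) {b : ℕ} →
               (∀ x → qr (φ x) ≤ b) → qr ψ ≤ b → qr (disjWhere xs f φ ψ) ≤ b
qr-disjWhere []       f φ ψ qφ qψ = qψ
qr-disjWhere (x ∷ xs) f φ ψ qφ qψ with f x
... | true  = ⊔-lub (qφ x) (qr-disjWhere xs f φ ψ qφ qψ)
... | false = qr-disjWhere xs f φ ψ qφ qψ

single : Fin n → Fin 1 → Fin n
single a = extend a (λ ())

map-extend-suc : (a : Fin n) (σ : Fin m → Fin n) (zs : List (Fin m)) → map (extend a σ) (map suc zs) ≡ map σ zs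
map-extend-suc a σ zs = sym (map-∘ zs)

extendVars : List (Fin m) → List (Fin (suc m))
extendVars zs = map suc zs ++ zero ∷ []

length-extendVars : (zs : List (Fin m)) → length (extendVars zs) ≡ suc (length zs)
length-extendVars zs = trans (length-++ (map suc zs)) (trans (cong (_+ 1) (length-map suc zs)) (+-comm _ 1))

length-extendVars+ : (zs : List (Fin m)) (r : ℕ) → length (extendVars zs) + r ≡ length zs + suc r
length-extendVars+ zs r = trans (cong (_+ r) (length-extendVars zs)) (sym (+-suc (length zs) r))

length-map-suc : (zs : List (Fin m)) → length (map Fin.suc zs) ≡ length zs + 0
length-map-suc zs = trans (length-map Fin.suc zs) (sym (+-identityʳ (length zs)))

map-extend-extendVars : (a : Fin n) (σ : Fin m → Fin n) (zs : List (Fin m)) (as : List (Fin n)) →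
                        map (extend a σ) (extendVars zs) ++ as ≡ map σ zs ++ a ∷ as
map-extend-extendVars a σ zs as = begin
  map (extend a σ) (extendVars zs) ++ as     ≡⟨ cong (_++ as) (map-++ (extend a σ) (map suc zs) _) ⟩
  (map (extend a σ) (map suc zs) ++ a ∷ []) ++ as      ≡⟨ ++-assoc (map (extend a σ) (map suc zs)) _ as ⟩
  map (extend a σ) (map suc zs) ++ a ∷ as              ≡⟨ cong (_++ a ∷ as) (map-extend-suc a σ zs) ⟩
  map σ zs ++ a ∷ as                                   ∎
  where open ≡-Reasoning

-- The Hintikka sentence

typeOverhead : ℕ → ℕ
typeOverhead k = 2 ^ suc k * (3 + k * 2) + 1 + 2 * (7 + k * 8 + 2 ^ suc k * (2 + k * 2))

typeOverhead≤cτ : (k : ℕ) → typeOverhead k ≤ cτ (suc k)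
typeOverhead≤cτ k = subst (λ X → overhead X ≤ 15 * suc k * (2 * X)) (suc-pred (2 ^ k) {{m^n≢0 2 k}})
  (≤-trans (m≤m+n (overhead (suc Y)) _) (≤-reflexive (identity k Y)))
  where
  Y : ℕ
  Y = pred (2 ^ k)
  overhead : ℕ → ℕ
  overhead X = 2 * X * (3 + k * 2) + 1 + 2 * (7 + k * 8 + 2 * X * (2 + k * 2))
  identity : ∀ k Y → 2 * suc Y * (3 + k * 2) + 1 + 2 * (7 + k * 8 + 2 * suc Y * (2 + k * 2)) + (1 + 2 * k + 16 * Y + 18 * k * Y)
                     ≡ 15 * suc k * (2 * suc Y)
  identity = solve-∀

module Hintikka {k n : ℕ} (M : Model (suc k) n) where

  types : List (TauType (suc k))
  types = allTypes (suc k)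

  count : TauType (suc k) → ℕ
  count = typeCount M

  countIs : {P : ℕ → Set} → Decidable P → Fin m → Form (suc k) m → Form (suc k) m
  countIs P? x ψ = disjWhere types (λ π → isYes (P? (count π))) (λ π → isType π x) ψ

  countIsNot : {P : ℕ → Set} → Decidable P → Fin m → Form (suc k) m → Form (suc k) m
  countIsNot P? x ψ = conjWhere types (λ π → isYes (P? (count π))) (λ π → notType π x) ψ

  amongFirst : ℕ → Fin m → List (Fin m) → Fin m → Form (suc k) m
  amongFirst j x []       y = neq y y
  amongFirst j x (z ∷ zs) y = countIsNot (_≟ j) x (eq y z ∨ᶠ amongFirst (suc j) x zs y)

  notAmongFirst : ℕ → Fin m → List (Fin m) → Fin m → Form (suc k) m
  notAmongFirst j x []       y = countIs (_≟ suc j) x (neq y y)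
  notAmongFirst j x (z ∷ zs) y = countIs (_≟ suc j) x (neq y z ∧ᶠ notAmongFirst (suc j) x zs y)

  atMost : ℕ → Fin m → List (Fin m) → Form (suc k) m
  atMost zero    x zs = allᶠ (diffType zero (suc x) ∨ᶠ amongFirst 0 (suc x) (map suc zs) zero)
  atMost (suc r) x zs = exᶠ (atMost r (suc x) (extendVars zs))

  atLeast : ℕ → Fin m → List (Fin m) → Form (suc k) m
  atLeast zero    x zs = exᶠ (sameType zero (suc x) ∧ᶠ notAmongFirst 0 (suc x) (map suc zs) zero)
  atLeast (suc r) x zs = allᶠ (atLeast r (suc x) (extendVars zs))

  -- x is its own first witness in atMost, so ℓ further variables handle counts up to ℓ + 1.
  exactCount : ℕ → Form (suc k) 1
  exactCount zero    = neq zero zero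
  exactCount (suc ℓ) = atMost ℓ zero (zero ∷ []) ∧ᶠ atLeast ℓ zero []

  rare : ℕ → TauType (suc k) → Bool
  rare ℓ π = isYes ((1 ≤? count π) ×-dec (count π ≤? ℓ))

  hintikka : ℕ → Sentence (suc k)
  hintikka ℓ = conjWhere types (rare ℓ) (λ π → exᶠ (isType π zero)) (allᶠ (countIs (suc ℓ ≤?_) zero (exactCount ℓ)))

  module _ (M' : Model (suc k) n) where

    expected : Fin n → ℕ
    expected a = count (typeOf M' a)

    typeGuard⇔ : {P : ℕ → Set} (P? : Decidable P) (a : Fin n) →
                 (∃[ π ] π ∈ types × isYes (P? (count π)) ≡ true × typeOf M' a ≗ π) ⇔ P (expected a)
    typeGuard⇔ {P} P? a = mk⇔
      (λ (π , _ , Pπ , a≗π) → subst P (typeCount-cong M (sym ∘ a≗π)) (to (isYes≡true⇔ (P? (count π))) Pπ))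
      λ Pa → let π , π∈ , π≗a = allTypes-complete (typeOf M' a)
             in π , π∈ , from (isYes≡true⇔ (P? (count π))) (subst P (sym (typeCount-cong M π≗a)) Pa) , sym ∘ π≗a

    Sat-countIs : {P : ℕ → Set} (P? : Decidable P) (x : Fin m) (ψ : Form (suc k) m) (σ : Fin m → Fin n) →
                  Sat M' (countIs P? x ψ) σ ⇔ (P (expected (σ x)) ⊎ Sat M' ψ σ)
    Sat-countIs P? x ψ σ = ⇔.trans (Sat-disjWhere M' types _ _ ψ)
      (⇔.trans (∃-⇔ (λ π → ⇔.refl ×-⇔ (⇔.refl ×-⇔ Sat-isType M' π x)) ⊎-⇔ ⇔.refl)
               (typeGuard⇔ P? (σ x) ⊎-⇔ ⇔.refl))

    Sat-countIsNot : {P : ℕ → Set} (P? : Decidable P) (x : Fin m) (ψ : Form (suc k) m) (σ : Fin m → Fin n) →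
                     Sat M' (countIsNot P? x ψ) σ ⇔ ((¬ P (expected (σ x))) × Sat M' ψ σ)
    Sat-countIsNot {P = P} P? x ψ σ = ⇔.trans (Sat-conjWhere M' types _ _ ψ) (guard ×-⇔ ⇔.refl)
      where
      guard : (∀ π → π ∈ types → isYes (P? (count π)) ≡ true → Sat M' (notType π x) σ) ⇔ (¬ P (expected (σ x)))
      guard = mk⇔
        (λ avoid Px → let π , π∈ , Pπ , x≗π = from (typeGuard⇔ P? (σ x)) Px
                      in to (Sat-notType M' π x) (avoid π π∈ Pπ) x≗π)
        (λ ¬Px π π∈ Pπ → from (Sat-notType M' π x) λ x≗π → ¬Px (to (typeGuard⇔ P? (σ x)) (π , π∈ , Pπ , x≗π)))

    Sat-amongFirst : (j : ℕ) (x : Fin m) (zs : List (Fin m)) (y : Fin m) (σ : Fin m → Fin n) {u : ℕ} →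
                     expected (σ x) ≡ j + u → Sat M' (amongFirst j x zs y) σ ⇔ σ y ∈ take u (map σ zs)
    Sat-amongFirst j x []       y σ {u} _ =
      mk⇔ (λ y≢y → contradiction refl y≢y) (λ y∈ → contradiction (subst (σ y ∈_) (take-[] u) y∈) λ ())
    Sat-amongFirst j x (z ∷ zs) y σ {zero} e≡j+0 = ⇔.trans (Sat-countIsNot (_≟ j) x _ σ)
      (mk⇔ (λ (e≢j , _) → contradiction (trans e≡j+0 (+-identityʳ j)) e≢j) λ ())
    Sat-amongFirst j x (z ∷ zs) y σ {suc u} e≡j+1+u = ⇔.trans (Sat-countIsNot (_≟ j) x _ σ) (mk⇔
      (λ { (_ , inj₁ y≡z) → here y≡z ; (_ , inj₂ later) → there (to rest⇔ later) })
      (λ { (here y≡z) → e≢j , inj₁ y≡z ; (there y∈) → e≢j , inj₂ (from rest⇔ y∈) }))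
      where
      e≢j : expected (σ x) ≢ j
      e≢j e≡j = m+1+n≢m j (trans (sym e≡j+1+u) e≡j)
      rest⇔ : Sat M' (amongFirst (suc j) x zs y) σ ⇔ σ y ∈ take u (map σ zs)
      rest⇔ = Sat-amongFirst (suc j) x zs y σ (trans e≡j+1+u (+-suc j u))

    Sat-notAmongFirst : (j : ℕ) (x : Fin m) (zs : List (Fin m)) (y : Fin m) (σ : Fin m → Fin n) {u : ℕ} →
                        expected (σ x) ≡ suc j + u → u ≤ length zs →
                        Sat M' (notAmongFirst j x zs y) σ ⇔ σ y ∉ take u (map σ zs)
    Sat-notAmongFirst j x []       y σ {zero} e≡1+j+0 _ = ⇔.trans (Sat-countIs (_≟ suc j) x _ σ)
      (mk⇔ (λ _ ()) λ _ → inj₁ (trans e≡1+j+0 (cong suc (+-identityʳ j))))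
    Sat-notAmongFirst j x (z ∷ zs) y σ {zero} e≡1+j+0 _ = ⇔.trans (Sat-countIs (_≟ suc j) x _ σ)
      (mk⇔ (λ _ ()) λ _ → inj₁ (trans e≡1+j+0 (cong suc (+-identityʳ j))))
    Sat-notAmongFirst j x (z ∷ zs) y σ {suc u} e≡1+j+1+u (s≤s u≤|zs|) = ⇔.trans (Sat-countIs (_≟ suc j) x _ σ) (mk⇔
      (λ { (inj₁ e≡1+j) → contradiction e≡1+j e≢1+j
         ; (inj₂ (y≢z , later)) → λ { (here y≡z) → y≢z y≡z ; (there y∈) → to rest⇔ later y∈ } })
      (λ y∉ → inj₂ ((λ y≡z → y∉ (here y≡z)) , from rest⇔ (y∉ ∘ there))))
      where
      e≢1+j : expected (σ x) ≢ suc j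
      e≢1+j e≡1+j = m+1+n≢m (suc j) (trans (sym e≡1+j+1+u) e≡1+j)
      rest⇔ : Sat M' (notAmongFirst (suc j) x zs y) σ ⇔ σ y ∉ take u (map σ zs)
      rest⇔ = Sat-notAmongFirst (suc j) x zs y σ (trans e≡1+j+1+u (cong suc (+-suc j u))) u≤|zs|

    Sat-atMost : (r : ℕ) (x : Fin m) (zs : List (Fin m)) (σ : Fin m → Fin n) {T : ℕ} → expected (σ x) ≡ T →
                 Sat M' (atMost r x zs) σ ⇔ (∃[ as ] length as ≡ r × Covers (take T (map σ zs ++ as)) (typeClass M' (σ x)))
    Sat-atMost zero x zs σ {T} e≡T = mk⇔
      (λ atMost → [] , refl , λ b b∼x → covered (atMost b) b∼x)
      (λ { ([] , refl , covers) b → classify b (covers b) })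
      where
      zs++[] : (b : Fin n) → map (extend b σ) (map suc zs) ≡ map σ zs ++ []
      zs++[] b = trans (map-extend-suc b σ zs) (sym (++-identityʳ (map σ zs)))
      among : (b : Fin n) → Sat M' (amongFirst 0 (suc x) (map suc zs) zero) (extend b σ) ⇔ b ∈ take T (map σ zs ++ [])
      among b = subst (λ L → Sat M' (amongFirst 0 (suc x) (map suc zs) zero) (extend b σ) ⇔ b ∈ take T L) (zs++[] b)
        (Sat-amongFirst 0 (suc x) (map suc zs) zero (extend b σ) e≡T)
      covered : ∀ {b} → Sat M' (diffType zero (suc x) ∨ᶠ amongFirst 0 (suc x) (map suc zs) zero) (extend b σ) →
             typeClass M' (σ x) b ≡ true → b ∈ take T (map σ zs ++ [])
      covered {b} (inj₁ b≁x) b∼x = contradiction (to (hasType≡true⇔ M' _ b) b∼x) (to (Sat-diffType M' zero (suc x)) b≁x)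
      covered {b} (inj₂ b∈)  _   = to (among b) b∈
      classify : ∀ b → (typeClass M' (σ x) b ≡ true → b ∈ take T (map σ zs ++ [])) →
               Sat M' (diffType zero (suc x) ∨ᶠ amongFirst 0 (suc x) (map suc zs) zero) (extend b σ)
      classify b covered with typeClass M' (σ x) b in b∼x
      ... | true  = inj₂ (from (among b) (covered refl))
      ... | false = inj₁ (from (Sat-diffType M' zero (suc x)) λ b≗x →
                      contradiction (trans (sym b∼x) (from (hasType≡true⇔ M' _ b) b≗x)) λ ())
    Sat-atMost (suc r) x zs σ {T} e≡T = mk⇔
      (λ (a , s) → let as , |as|≡r , covers = to (inner⇔ a) s
                   in a ∷ as , cong suc |as|≡r , subst (λ L → Covers (take T L) _) (map-extend-extendVars a σ zs as) covers)
      (λ { (a ∷ as , |as|≡1+r , covers) →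
           a , from (inner⇔ a)
                 (as , suc-injective |as|≡1+r , subst (λ L → Covers (take T L) _) (sym (map-extend-extendVars a σ zs as)) covers) })
      where
      inner⇔ : (a : Fin n) → Sat M' (atMost r (suc x) (extendVars zs)) (extend a σ) ⇔
           (∃[ as ] length as ≡ r × Covers (take T (map (extend a σ) (extendVars zs) ++ as)) (typeClass M' (σ x)))
      inner⇔ a = Sat-atMost r (suc x) (extendVars zs) (extend a σ) e≡T

    Sat-atLeast : (r : ℕ) (x : Fin m) (zs : List (Fin m)) (σ : Fin m → Fin n) {u : ℕ} →
                  expected (σ x) ≡ suc u → u ≤ length zs + r →
                  Sat M' (atLeast r x zs) σ ⇔
                  (∀ as → length as ≡ r → ∃[ b ] typeClass M' (σ x) b ≡ true × b ∉ take u (map σ zs ++ as))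
    Sat-atLeast zero x zs σ {u} e≡1+u u≤|zs|+0 = mk⇔
      (λ { (b , b∼x , b∉) [] refl →
           b , from (hasType≡true⇔ M' _ b) (to (Sat-sameType M' zero (suc x)) b∼x) , to (outside b) b∉ })
      (λ escapes → witness (escapes [] refl))
      where
      u≤|zs| : u ≤ length (map suc zs)
      u≤|zs| = subst (u ≤_) (sym (length-map-suc zs)) u≤|zs|+0
      outside : (b : Fin n) → Sat M' (notAmongFirst 0 (suc x) (map suc zs) zero) (extend b σ) ⇔ b ∉ take u (map σ zs ++ [])
      outside b = subst (λ L → Sat M' (notAmongFirst 0 (suc x) (map suc zs) zero) (extend b σ) ⇔ b ∉ take u L)
        (trans (map-extend-suc b σ zs) (sym (++-identityʳ (map σ zs))))
        (Sat-notAmongFirst 0 (suc x) (map suc zs) zero (extend b σ) e≡1+u u≤|zs|)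
      witness : (∃[ b ] typeClass M' (σ x) b ≡ true × b ∉ take u (map σ zs ++ [])) → Sat M' (atLeast zero x zs) σ
      witness (b , b∼x , b∉) = b , from (Sat-sameType M' zero (suc x)) (to (hasType≡true⇔ M' _ b) b∼x) , from (outside b) b∉
    Sat-atLeast (suc r) x zs σ {u} e≡1+u u≤|zs|+1+r = mk⇔
      (λ atLeast → λ { (a ∷ as) |as|≡1+r →
         subst Escapes (map-extend-extendVars a σ zs as) (to (inner⇔ a) (atLeast a) as (suc-injective |as|≡1+r)) })
      (λ { escapes a → from (inner⇔ a) λ as |as|≡r →
         subst Escapes (sym (map-extend-extendVars a σ zs as)) (escapes (a ∷ as) (cong suc |as|≡r)) })
      where
      Escapes : List (Fin n) → Set
      Escapes L = ∃[ b ] typeClass M' (σ x) b ≡ true × b ∉ take u L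
      inner⇔ : (a : Fin n) → Sat M' (atLeast r (suc x) (extendVars zs)) (extend a σ) ⇔
           (∀ as → length as ≡ r → ∃[ b ] typeClass M' (σ x) b ≡ true × b ∉ take u (map (extend a σ) (extendVars zs) ++ as))
      inner⇔ a = Sat-atLeast r (suc x) (extendVars zs) (extend a σ) e≡1+u
                   (subst (u ≤_) (sym (length-extendVars+ zs r)) u≤|zs|+1+r)

    inOwnClass : (a : Fin n) → typeClass M' a a ≡ true
    inOwnClass a = from (hasType≡true⇔ M' _ a) λ _ → refl

    0<classSize : (a : Fin n) → 0 < typeCount M' (typeOf M' a)
    0<classSize a = ∃⇒0<countFin (typeClass M' a) (inOwnClass a)

    Sat-atMost-self : (ℓ : ℕ) (a : Fin n) {e : ℕ} → expected a ≡ e → e ≤ suc ℓ →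
                      Sat M' (atMost ℓ zero (zero ∷ [])) (single a) ⇔ typeCount M' (typeOf M' a) ≤ e
    Sat-atMost-self ℓ a e≡ e≤1+ℓ = ⇔.trans (Sat-atMost ℓ zero (zero ∷ []) (single a) e≡)
      (⇔.sym (countFin≤⇔covered (typeClass M' a) (inOwnClass a) e≤1+ℓ))

    Sat-atLeast-self : (ℓ : ℕ) (a : Fin n) {u : ℕ} → expected a ≡ suc u → u ≤ ℓ →
                       Sat M' (atLeast ℓ zero []) (single a) ⇔ suc u ≤ typeCount M' (typeOf M' a)
    Sat-atLeast-self ℓ a e≡1+u u≤ℓ = ⇔.trans (Sat-atLeast ℓ zero [] (single a) e≡1+u u≤ℓ)
      (⇔.sym (≤countFin⇔uncovered (typeClass M' a) (inOwnClass a) u≤ℓ))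

    Sat-exactCount : (ℓ : ℕ) (a : Fin n) {e : ℕ} → expected a ≡ e → e ≤ ℓ →
                     Sat M' (exactCount ℓ) (single a) ⇔ typeCount M' (typeOf M' a) ≡ e
    Sat-exactCount zero a {zero} _ _ =
      mk⇔ (λ a≢a → contradiction refl a≢a) (λ count≡0 → contradiction (subst (0 <_) count≡0 (0<classSize a)) λ ())
    Sat-exactCount (suc ℓ) a {zero} e≡0 _ = mk⇔
      (λ (atMost , _) → contradiction (to (Sat-atMost-self ℓ a e≡0 z≤n) atMost) (<⇒≱ (0<classSize a)))
      (λ count≡0 → contradiction (subst (0 <_) count≡0 (0<classSize a)) λ ())
    Sat-exactCount (suc ℓ) a {suc u} e≡1+u (s≤s u≤ℓ) =
      ⇔.trans (Sat-atMost-self ℓ a e≡1+u (s≤s u≤ℓ) ×-⇔ Sat-atLeast-self ℓ a e≡1+u u≤ℓ)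
              (mk⇔ (λ (≤e , e≤) → ≤-antisym ≤e e≤) λ count≡e → ≤-reflexive count≡e , ≤-reflexive (sym count≡e))

    Sat-hintikka : (ℓ : ℕ) → Sat M' (hintikka ℓ) (λ ()) ⇔ M ≡[ suc ℓ ] M'
    Sat-hintikka ℓ = ⇔.trans (Sat-conjWhere M' types _ _ _) (⇔.trans (realized ×-⇔ exact) (⇔.sym (≡[1+ℓ]⇔ M M' ℓ)))
      where
      realized : (∀ π → π ∈ types → rare ℓ π ≡ true → ∃[ a ] Sat M' (isType π zero) (single a)) ⇔
                 (∀ π → 1 ≤ count π → count π ≤ ℓ → ∃[ a ] typeOf M' a ≗ π)
      realized = mk⇔
        (λ { listed π 1≤c c≤ℓ →
           let π₁ , π₁∈ , π₁≗π = allTypes-complete π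
               c₁≡c = typeCount-cong M π₁≗π
               a , a⊨π₁ = listed π₁ π₁∈
                            (from (isYes≡true⇔ _) (subst (1 ≤_) (sym c₁≡c) 1≤c , subst (_≤ ℓ) (sym c₁≡c) c≤ℓ))
           in a , λ R → trans (to (Sat-isType M' π₁ zero) a⊨π₁ R) (π₁≗π R) })
        (λ { realizes π _ bounded → let 1≤c , c≤ℓ = to (isYes≡true⇔ _) bounded
                                        a , a≗π = realizes π 1≤c c≤ℓ
                                    in a , from (Sat-isType M' π zero) a≗π })
      exact : (∀ a → Sat M' (countIs (suc ℓ ≤?_) zero (exactCount ℓ)) (single a)) ⇔
              (∀ a → expected a ≤ ℓ → typeCount M' (typeOf M' a) ≡ expected a)
      exact = ∀-⇔ λ a → ⇔.trans (Sat-countIs (suc ℓ ≤?_) zero (exactCount ℓ) (single a)) (mk⇔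
        (λ { (inj₁ ℓ<e) e≤ℓ → contradiction e≤ℓ (<⇒≱ ℓ<e)
           ; (inj₂ s)   e≤ℓ → to (Sat-exactCount ℓ a refl e≤ℓ) s })
        λ exactIfSmall → largeOrExact (suc ℓ ≤? expected a) exactIfSmall)
        where
        largeOrExact : ∀ {a} → Dec (suc ℓ ≤ expected a) → (expected a ≤ ℓ → typeCount M' (typeOf M' a) ≡ expected a) →
               suc ℓ ≤ expected a ⊎ Sat M' (exactCount ℓ) (single a)
        largeOrExact (yes ℓ<e) _ = inj₁ ℓ<e
        largeOrExact {a} (no ℓ≮e) exactIfSmall =
          let e≤ℓ = ≤-pred (≰⇒> ℓ≮e) in inj₂ (from (Sat-exactCount ℓ a refl e≤ℓ) (exactIfSmall e≤ℓ))

  inRange : ℕ → ℕ → ℕ → Bool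
  inRange j zero    v = false
  inRange j (suc w) v = isYes (v ≟ j) ∨ inRange (suc j) w v

  inRange⇒≤ : (j w v : ℕ) → inRange j w v ≡ true → j ≤ v
  inRange⇒≤ j (suc w) v inside with v ≟ j
  ... | yes v≡j = ≤-reflexive (sym v≡j)
  ... | no  _   = <⇒≤ (inRange⇒≤ (suc j) w v inside)

  countInRange : ℕ → ℕ → ℕ
  countInRange j w = countWhere (λ π → inRange j w (count π)) types

  countInRange-zero : (j : ℕ) → countInRange j 0 ≡ 0
  countInRange-zero j = countWhere-false types

  countInRange-suc : (j w : ℕ) → countInRange j (suc w) ≡ countWhere (λ π → isYes (count π ≟ j)) types + countInRange (suc j) w
  countInRange-suc j w = countWhere-∨ _ _ disjoint types
    where
    disjoint : ∀ π → isYes (count π ≟ j) ≡ true → inRange (suc j) w (count π) ≡ false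
    disjoint π c≡j = Bool.¬-not λ later →
      <-irrefl (sym (to (isYes≡true⇔ (count π ≟ j)) c≡j)) (inRange⇒≤ (suc j) w (count π) later)

  countInRange≤ : (j w : ℕ) → countInRange j w ≤ 2 ^ suc k
  countInRange≤ j w = ≤-trans (countWhere≤length _ types) (≤-reflexive (length-allTypes (suc k)))

  size-countIs : {P : ℕ → Set} (P? : Decidable P) (x : Fin m) (ψ : Form (suc k) m) →
                 size (countIs P? x ψ) ≡ countWhere (λ π → isYes (P? (count π))) types * (2 + k * 2) + size ψ
  size-countIs P? x ψ = size-disjWhere types _ _ ψ λ π → size-isType π x

  size-countIsNot : {P : ℕ → Set} (P? : Decidable P) (x : Fin m) (ψ : Form (suc k) m) →
                    size (countIsNot P? x ψ) ≡ countWhere (λ π → isYes (P? (count π))) types * (2 + k * 2) + size ψ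
  size-countIsNot P? x ψ = size-conjWhere types _ _ ψ λ π → size-notType π x

  size-chainStep : ∀ c N W l → c * W + (2 + (N * W + (2 * l + 1))) ≡ (c + N) * W + (2 * suc l + 1)
  size-chainStep = solve-∀

  size-amongFirst : (j : ℕ) (x : Fin m) (zs : List (Fin m)) (y : Fin m) →
                    size (amongFirst j x zs y) ≡ countInRange j (length zs) * (2 + k * 2) + (2 * length zs + 1)
  size-amongFirst j x []       y = cong (λ c → c * (2 + k * 2) + 1) (sym (countInRange-zero j))
  size-amongFirst j x (z ∷ zs) y = begin
    size (amongFirst j x (z ∷ zs) y)
      ≡⟨ size-countIsNot (_≟ j) x _ ⟩
    c * (2 + k * 2) + (2 + size (amongFirst (suc j) x zs y))
      ≡⟨ cong (λ s → c * (2 + k * 2) + (2 + s)) (size-amongFirst (suc j) x zs y) ⟩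
    c * (2 + k * 2) + (2 + (countInRange (suc j) (length zs) * (2 + k * 2) + (2 * length zs + 1)))
      ≡⟨ size-chainStep c _ _ (length zs) ⟩
    (c + countInRange (suc j) (length zs)) * (2 + k * 2) + (2 * suc (length zs) + 1)
      ≡⟨ cong (λ N → N * (2 + k * 2) + (2 * suc (length zs) + 1)) (sym (countInRange-suc j (length zs))) ⟩
    countInRange j (suc (length zs)) * (2 + k * 2) + (2 * suc (length zs) + 1) ∎
    where
    open ≡-Reasoning
    c : ℕ
    c = countWhere (λ π → isYes (count π ≟ j)) types

  size-notAmongFirst : (j : ℕ) (x : Fin m) (zs : List (Fin m)) (y : Fin m) →
                       size (notAmongFirst j x zs y) ≡ countInRange (suc j) (suc (length zs)) * (2 + k * 2) + (2 * length zs + 1)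
  size-notAmongFirst j x []       y = begin
    size (notAmongFirst j x [] y)
      ≡⟨ size-countIs (_≟ suc j) x _ ⟩
    c * (2 + k * 2) + 1
      ≡⟨ cong (λ N → N * (2 + k * 2) + 1) (sym countInRange-one) ⟩
    countInRange (suc j) 1 * (2 + k * 2) + 1 ∎
    where
    open ≡-Reasoning
    c : ℕ
    c = countWhere (λ π → isYes (count π ≟ suc j)) types
    countInRange-one : countInRange (suc j) 1 ≡ c
    countInRange-one = trans (countInRange-suc (suc j) 0) (trans (cong (c +_) (countInRange-zero (suc (suc j)))) (+-identityʳ c))
  size-notAmongFirst j x (z ∷ zs) y = begin
    size (notAmongFirst j x (z ∷ zs) y)
      ≡⟨ size-countIs (_≟ suc j) x _ ⟩
    c * (2 + k * 2) + (2 + size (notAmongFirst (suc j) x zs y))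
      ≡⟨ cong (λ s → c * (2 + k * 2) + (2 + s)) (size-notAmongFirst (suc j) x zs y) ⟩
    c * (2 + k * 2) + (2 + (countInRange (suc (suc j)) (suc (length zs)) * (2 + k * 2) + (2 * length zs + 1)))
      ≡⟨ size-chainStep c _ _ (length zs) ⟩
    (c + countInRange (suc (suc j)) (suc (length zs))) * (2 + k * 2) + (2 * suc (length zs) + 1)
      ≡⟨ cong (λ N → N * (2 + k * 2) + (2 * suc (length zs) + 1)) (sym (countInRange-suc (suc j) (suc (length zs)))) ⟩
    countInRange (suc j) (suc (suc (length zs))) * (2 + k * 2) + (2 * suc (length zs) + 1) ∎
    where
    open ≡-Reasoning
    c : ℕ
    c = countWhere (λ π → isYes (count π ≟ suc j)) types

  chainBound : ℕ → ℕ
  chainBound l = 2 ^ suc k * (2 + k * 2) + (2 * l + 1)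

  size-amongFirst≤ : (j : ℕ) (x : Fin m) (zs : List (Fin m)) (y : Fin m) → size (amongFirst j x zs y) ≤ chainBound (length zs)
  size-amongFirst≤ j x zs y = ≤-trans (≤-reflexive (size-amongFirst j x zs y))
    (+-monoˡ-≤ _ (*-monoˡ-≤ (2 + k * 2) (countInRange≤ j (length zs))))

  size-notAmongFirst≤ : (j : ℕ) (x : Fin m) (zs : List (Fin m)) (y : Fin m) → size (notAmongFirst j x zs y) ≤ chainBound (length zs)
  size-notAmongFirst≤ j x zs y = ≤-trans (≤-reflexive (size-notAmongFirst j x zs y))
    (+-monoˡ-≤ _ (*-monoˡ-≤ (2 + k * 2) (countInRange≤ (suc j) (suc (length zs)))))

  size-atMost≤ : (r : ℕ) (x : Fin m) (zs : List (Fin m)) →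
                 size (atMost r x zs) ≤ r + (2 + (7 + k * 8) + chainBound (length zs + r))
  size-atMost≤ zero x zs = +-mono-≤ (≤-reflexive (cong (2 +_) (size-diffType {k = k} zero (suc x))))
    (subst (λ l → size (amongFirst 0 (suc x) (map suc zs) zero) ≤ chainBound l) (length-map-suc zs)
      (size-amongFirst≤ 0 (suc x) (map suc zs) zero))
  size-atMost≤ (suc r) x zs = s≤s
    (subst (λ l → size (atMost r (suc x) (extendVars zs)) ≤ r + (2 + (7 + k * 8) + chainBound l)) (length-extendVars+ zs r)
      (size-atMost≤ r (suc x) (extendVars zs)))

  size-atLeast≤ : (r : ℕ) (x : Fin m) (zs : List (Fin m)) →
                  size (atLeast r x zs) ≤ r + (2 + (7 + k * 8) + chainBound (length zs + r))
  size-atLeast≤ zero x zs = +-mono-≤ (≤-reflexive (cong (2 +_) (size-sameType {k = k} zero (suc x))))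
    (subst (λ l → size (notAmongFirst 0 (suc x) (map suc zs) zero) ≤ chainBound l) (length-map-suc zs)
      (size-notAmongFirst≤ 0 (suc x) (map suc zs) zero))
  size-atLeast≤ (suc r) x zs = s≤s
    (subst (λ l → size (atLeast r (suc x) (extendVars zs)) ≤ r + (2 + (7 + k * 8) + chainBound l)) (length-extendVars+ zs r)
      (size-atLeast≤ r (suc x) (extendVars zs)))

  size-exactCount≤ : (ℓ : ℕ) → size (exactCount ℓ) ≤ 6 * ℓ + 3 + 2 * (7 + k * 8 + 2 ^ suc k * (2 + k * 2))
  size-exactCount≤ zero    = s≤s z≤n
  size-exactCount≤ (suc ℓ) = ≤-trans (s≤s (+-mono-≤ (size-atMost≤ ℓ zero (zero ∷ [])) (size-atLeast≤ ℓ zero [])))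
    (≤-reflexive (sum (7 + k * 8) (2 ^ suc k * (2 + k * 2)) ℓ))
    where
    sum : ∀ D B ℓ → suc ((ℓ + (2 + D + (B + (2 * (1 + ℓ) + 1)))) + (ℓ + (2 + D + (B + (2 * ℓ + 1)))))
                    ≡ 6 * suc ℓ + 3 + 2 * (D + B)
    sum = solve-∀

  size-hintikka≤ : (ℓ : ℕ) → size (hintikka ℓ) ≤ 6 * ℓ + 3 + typeOverhead k
  size-hintikka≤ ℓ = begin
    size (hintikka ℓ)
      ≡⟨ size-conjWhere types (rare ℓ) _ _ (λ π → cong suc (size-isType π zero)) ⟩
    E * (3 + k * 2) + suc (size (countIs (suc ℓ ≤?_) zero (exactCount ℓ)))
      ≡⟨ cong (λ s → E * (3 + k * 2) + suc s) (size-countIs (suc ℓ ≤?_) zero (exactCount ℓ)) ⟩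
    E * (3 + k * 2) + suc (L * (2 + k * 2) + size (exactCount ℓ))
      ≡⟨ regroup E L k (size (exactCount ℓ)) ⟩
    (E * (3 + k * 2) + L * (2 + k * 2)) + suc (size (exactCount ℓ))
      ≤⟨ +-mono-≤ typesPart (s≤s (size-exactCount≤ ℓ)) ⟩
    2 ^ suc k * (3 + k * 2) + suc (6 * ℓ + 3 + 2 * (7 + k * 8 + 2 ^ suc k * (2 + k * 2)))
      ≡⟨ regroup₁ (2 ^ suc k * (3 + k * 2)) ℓ (7 + k * 8 + 2 ^ suc k * (2 + k * 2)) ⟩
    6 * ℓ + 3 + typeOverhead k ∎
    where
    open ≤-Reasoning
    large : TauType (suc k) → Bool
    large π = isYes (suc ℓ ≤? count π)
    E L : ℕ
    E = countWhere (rare ℓ) types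
    L = countWhere large types
    disjoint : ∀ π → rare ℓ π ≡ true → large π ≡ false
    disjoint π bounded = Bool.¬-not λ isLarge →
      <⇒≱ (to (isYes≡true⇔ (suc ℓ ≤? count π)) isLarge)
          (proj₂ (to (isYes≡true⇔ ((1 ≤? count π) ×-dec (count π ≤? ℓ))) bounded))
    E+L≤ : E + L ≤ 2 ^ suc k
    E+L≤ = ≤-trans (≤-reflexive (sym (countWhere-∨ (rare ℓ) large disjoint types)))
                   (≤-trans (countWhere≤length _ types) (≤-reflexive (length-allTypes (suc k))))
    typesPart : E * (3 + k * 2) + L * (2 + k * 2) ≤ 2 ^ suc k * (3 + k * 2)
    typesPart = ≤-trans (+-monoʳ-≤ (E * (3 + k * 2)) (*-monoʳ-≤ L (n≤1+n (2 + k * 2))))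
                (≤-trans (≤-reflexive (sym (*-distribʳ-+ (3 + k * 2) E L))) (*-monoˡ-≤ (3 + k * 2) E+L≤))
    regroup : ∀ E L k S → E * (3 + k * 2) + suc (L * (2 + k * 2) + S) ≡
                          (E * (3 + k * 2) + L * (2 + k * 2)) + suc S
    regroup = solve-∀
    regroup₁ : ∀ N ℓ C → N + suc (6 * ℓ + 3 + 2 * C) ≡ 6 * ℓ + 3 + (N + 1 + 2 * C)
    regroup₁ = solve-∀

  qr-countIs : {P : ℕ → Set} (P? : Decidable P) (x : Fin m) (ψ : Form (suc k) m) {b : ℕ} →
               qr ψ ≤ b → qr (countIs P? x ψ) ≤ b
  qr-countIs P? x ψ qψ = qr-disjWhere types _ _ ψ (λ π → ≤-trans (qr-isType π x) z≤n) qψ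

  qr-countIsNot : {P : ℕ → Set} (P? : Decidable P) (x : Fin m) (ψ : Form (suc k) m) {b : ℕ} →
                  qr ψ ≤ b → qr (countIsNot P? x ψ) ≤ b
  qr-countIsNot P? x ψ qψ = qr-conjWhere types _ _ ψ (λ π → ≤-trans (qr-notType π x) z≤n) qψ

  qr-amongFirst : (j : ℕ) (x : Fin m) (zs : List (Fin m)) (y : Fin m) → qr (amongFirst j x zs y) ≤ 0
  qr-amongFirst j x []       y = z≤n
  qr-amongFirst j x (z ∷ zs) y = qr-countIsNot (_≟ j) x _ (⊔-lub z≤n (qr-amongFirst (suc j) x zs y))

  qr-notAmongFirst : (j : ℕ) (x : Fin m) (zs : List (Fin m)) (y : Fin m) → qr (notAmongFirst j x zs y) ≤ 0
  qr-notAmongFirst j x []       y = qr-countIs (_≟ suc j) x _ z≤n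
  qr-notAmongFirst j x (z ∷ zs) y = qr-countIs (_≟ suc j) x _ (⊔-lub z≤n (qr-notAmongFirst (suc j) x zs y))

  qr-atMost : (r : ℕ) (x : Fin m) (zs : List (Fin m)) → qr (atMost r x zs) ≤ suc r
  qr-atMost zero    x zs = s≤s (⊔-lub (qr-diffType {k = k} zero (suc x)) (qr-amongFirst 0 (suc x) (map suc zs) zero))
  qr-atMost (suc r) x zs = s≤s (qr-atMost r (suc x) (extendVars zs))

  qr-atLeast : (r : ℕ) (x : Fin m) (zs : List (Fin m)) → qr (atLeast r x zs) ≤ suc r
  qr-atLeast zero    x zs = s≤s (⊔-lub (qr-sameType {k = k} zero (suc x)) (qr-notAmongFirst 0 (suc x) (map suc zs) zero))
  qr-atLeast (suc r) x zs = s≤s (qr-atLeast r (suc x) (extendVars zs))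

  qr-exactCount : (ℓ : ℕ) → qr (exactCount ℓ) ≤ ℓ
  qr-exactCount zero    = z≤n
  qr-exactCount (suc ℓ) = ⊔-lub (qr-atMost ℓ zero (zero ∷ [])) (qr-atLeast ℓ zero [])

  qr-hintikka : (ℓ : ℕ) → qr (hintikka ℓ) ≤ suc ℓ
  qr-hintikka ℓ = qr-conjWhere types _ _ _ (λ π → s≤s (≤-trans (qr-isType π zero) z≤n))
    (s≤s (qr-countIs (suc ℓ ≤?_) zero (exactCount ℓ) (qr-exactCount ℓ)))

6*[1+ℓ]∸3 : (ℓ : ℕ) → 6 * suc ℓ ∸ 3 ≡ 6 * ℓ + 3
6*[1+ℓ]∸3 ℓ = trans (cong (_∸ 3) (6*[1+ℓ] ℓ)) (m+n∸m≡n 3 (6 * ℓ + 3))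
  where
  6*[1+ℓ] : ∀ ℓ → 6 * suc ℓ ≡ 3 + (6 * ℓ + 3)
  6*[1+ℓ] = solve-∀

corollary2 : (k d n : ℕ) → 1 ≤ d → (M : Model k n) →
    Σ (Sentence k) (λ φ → (qr φ ≤ d) × (size φ ≤ (6 * d ∸ 3) + cτ k)
      × ((M' : Model k n) → (M' ⊨ φ) ⇔ (M ≡[ d ] M')))
corollary2 zero (suc ℓ) n _ M =
  allᶠ (eq zero zero) , s≤s z≤n , size≤ , λ M' → mk⇔ (λ _ → emptyVocabulary-≡ M M' (suc ℓ)) (λ _ _ → refl)
  where
  size≤ : 2 ≤ 6 * suc ℓ ∸ 3 + cτ 0
  size≤ = subst (2 ≤_) (sym (trans (+-identityʳ _) (6*[1+ℓ]∸3 ℓ))) (≤-trans (s≤s (s≤s z≤n)) (m≤n+m 3 (6 * ℓ)))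
corollary2 (suc k) (suc ℓ) n _ M = hintikka ℓ , qr-hintikka ℓ , size≤ , λ M' → Sat-hintikka M' ℓ
  where
  open Hintikka M
  size≤ : size (hintikka ℓ) ≤ 6 * suc ℓ ∸ 3 + cτ (suc k)
  size≤ = ≤-trans (size-hintikka≤ ℓ)
            (subst (λ s → 6 * ℓ + 3 + typeOverhead k ≤ s + cτ (suc k)) (sym (6*[1+ℓ]∸3 ℓ))
              (+-monoʳ-≤ (6 * ℓ + 3) (typeOverhead≤cτ k)))
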